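{- Let $n\ge 1$, let $\xi$ be a primitive element of $\mathbb{F}_{2^n}$ and let $k,k'\in\mathbb{Z}_{2^n-1}\setminus\{0\}$. (i) If $C(k)=C(k')$, then $C(-k)=C(-k')$ and $C(\mathrm{Z}(k))=C(\mathrm{Z}(k'))$. (ii) If $n$ is odd, then $C(k)\ne C(-k)$, $C(k)\ne C(\mathrm{Z}(k))$, and $C(k)\ne C(-\mathrm{Z}(-k))$. (iii) If $n$ is not divisible by $3$ and $3k\ne0$, then $C(-\mathrm{Z}(k))\ne C(k)\ne C(\mathrm{Z}(-k))$.
   Context: Elements of $\mathbb{Z}_{2^n-1}$ are exponents of $\xi$. For nonzero $k$, the Zech logarithm $\mathrm{Z}(k)$ is defined by $1+\xi^k=\xi^{\mathrm{Z}(k)}$. For $k\in\mathbb{Z}_{2^n-1}$, $C(k)=\{2^ik \bmod (2^n-1): i\ge0\}$ is the $2$-cyclotomic class containing $k$. -}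

module Defs where

open import Level using (Level; _⊔_)
open import Data.Nat using (ℕ; zero; suc; _∸_; _<_; NonZero)
open import Data.Nat as ℕ using ()
open import Data.Nat.DivMod using (_%_)
open import Data.Nat.Properties using (m^n>0; ≤-trans; m≤n+m)
open import Data.Product using (_×_; ∃; ∃-syntax)
open import Relation.Nullary using (¬_)
open import Relation.Binary.PropositionalEquality using (_≡_)
open import Algebra.Bundles using (CommutativeRing; Semiring)
import Algebra.Definitions.RawSemiring as RS

-- The modulus 2^n - 1 (order of the multiplicative group of F_{2^n}).
Nn : ℕ → ℕ
Nn n = 2 ℕ.^ n ∸ 1

Nn-nonZero : ∀ n → .{{NonZero n}} → NonZero (Nn n)
Nn-nonZero (suc n) with 2 ℕ.^ n | m^n>0 2 n
... | suc m | _ = ℕ.>-nonZero (≤-trans (ℕ.s≤s ℕ.z≤n) (m≤n+m (suc (m ℕ.+ 0)) m))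

-- Arithmetic in Z_{2^n - 1}, elements represented by naturals (reduced mod 2^n - 1).
module ZN (n : ℕ) .{{nz : NonZero n}} where
  private
    instance
      nzN : NonZero (Nn n)
      nzN = Nn-nonZero n

  -- additive inverse in Z_{2^n-1} (for 0 ≤ a < 2^n-1)
  neg : ℕ → ℕ
  neg a = (Nn n ∸ a) % Nn n

  InC : ℕ → ℕ → Set
  InC k j = ∃[ i ] (j % Nn n ≡ (2 ℕ.^ i ℕ.* k) % Nn n)

  SameClass : ℕ → ℕ → Set
  SameClass k k' = ∀ j → (InC k j → InC k' j) × (InC k' j → InC k j)

  ThreeKZero : ℕ → Set
  ThreeKZero k = (3 ℕ.* k) % Nn n ≡ 0

module FieldDefs {c ℓ : Level} (R : CommutativeRing c ℓ) where
  open CommutativeRing R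
  open RS (Semiring.rawSemiring semiring) using () renaming (_^_ to _^ᴿ_)

  IsField : Set (c ⊔ ℓ)
  IsField = (¬ (1# ≈ 0#)) × (∀ x → ¬ (x ≈ 0#) → ∃[ y ] (x * y ≈ 1#))

  -- ξ is a primitive element of a field with 2^n elements: ξ has multiplicative
  -- order exactly 2^n - 1 and every nonzero element is a power ξ^k, 0 ≤ k < 2^n-1.
  -- (Together these force |R| = 2^n, i.e. R ≅ F_{2^n}.)
  IsPrimitiveOf : ℕ → Carrier → Set (c ⊔ ℓ)
  IsPrimitiveOf n ξ =
    (ξ ^ᴿ Nn n ≈ 1#)
    × (∀ k → 0 < k → k < Nn n → ¬ (ξ ^ᴿ k ≈ 1#))
    × (∀ x → ¬ (x ≈ 0#) → ∃[ k ] (k < Nn n × x ≈ ξ ^ᴿ k))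

  IsZech : Carrier → ℕ → ℕ → Set ℓ
  IsZech ξ k z = 1# + ξ ^ᴿ k ≈ ξ ^ᴿ z

{-# OPTIONS --safe #-}
module Submission where

-- The field has characteristic 2: −1 is a power of ξ with square 1, and ξ has odd order 2ⁿ − 1.
-- So Fᵢ x = x^(2^i) is a ring endomorphism, and C(k) = C(k') says that ξ^k' = Fᵢ (ξ^k) for some i.
-- Fᵢ commutes with x ↦ 1/x and x ↦ 1 + x, which gives (i). In (ii) and (iii) a coincidence of
-- classes makes x = ξ^(±k) satisfy Fᵢ x = 1/x, Fᵢ x = 1 + x or x = 1/(1 + Fᵢ x). Iterating twice,
-- resp. three times (b ↦ 1/(1+b) has order 3), gives F₂ᵢ x = x resp. F₃ᵢ x = x; together with
-- Fₙ x = x and gcd(2, n) = 1 resp. gcd(3, n) = 1 this forces Fᵢ x = x. Then x² = 1, 1 = 0, or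
-- x² + x + 1 = 0 (so x³ = 1), contradicting k ≠ 0, the field axioms, or 3k ≠ 0.

open import Defs
open import Level using (Level)
open import Data.Nat using (ℕ; _<_; NonZero)
open import Data.Nat.Divisibility using (_∣_)
open import Data.Product using (_×_)
open import Relation.Nullary using (¬_)
open import Algebra.Bundles using (CommutativeRing)

open import Data.Nat as ℕ using (zero; suc; _≤_; z≤n; s≤s)
import Data.Nat.Properties as ℕₚ
open import Data.Nat.DivMod using (_%_; _/_; m≡m%n+[m/n]*n; m%n<n; m*n%n≡0)
open import Data.Nat.Divisibility using (divides; n∣m*n; n∣m*n*o; *-monoˡ-∣)
open import Data.Nat.Coprimality using (Coprime; coprime-Bézout)
open import Data.Nat.GCD using (module Bézout)
open import Data.Nat.Primality using (Prime; prime[2]; prime?; prime⇒irreducible)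
open import Data.Product using (_,_; proj₁; proj₂; ∃-syntax; swap)
open import Data.Sum using (inj₁; inj₂)
open import Relation.Nullary using (contradiction)
open import Relation.Nullary.Decidable using (toWitness)
open import Relation.Binary.PropositionalEquality as ≡ using (_≡_; refl; cong; subst)
import Algebra.Properties.Ring as RingProperties
import Algebra.Properties.CommutativeSemiring.Exp as ExpProperties
import Algebra.Properties.CommutativeSemigroup as CommutativeSemigroupProperties
import Relation.Binary.Reasoning.Setoid as SetoidReasoning

suc[Nn]≡2^n : ∀ n → suc (Nn n) ≡ 2 ℕ.^ n
suc[Nn]≡2^n n with 2 ℕ.^ n | ℕₚ.m^n>0 2 n
... | suc _ | _ = refl

Nn-odd : ∀ n → .{{NonZero n}} → ∃[ m ] Nn n ≡ suc (2 ℕ.* m)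
Nn-odd (suc n) with 2 ℕ.^ n | ℕₚ.m^n>0 2 n
... | suc m | _ = m , ℕₚ.+-suc m (m ℕ.+ 0)

prime∤⇒coprime : ∀ {p n} → Prime p → ¬ p ∣ n → Coprime p n
prime∤⇒coprime p-prime p∤n (d∣p , d∣n) with prime⇒irreducible p-prime d∣p
... | inj₁ d≡1 = d≡1
... | inj₂ refl = contradiction d∣n p∤n

prime[3] : Prime 3
prime[3] = toWitness {a? = prime? 3} _

module Frobenius {c ℓ : Level} (R : CommutativeRing c ℓ) where
  open CommutativeRing R renaming (refl to ≈-refl)
  open ExpProperties commutativeSemiring
  open CommutativeSemigroupProperties *-commutativeSemigroup using (interchange)
  open SetoidReasoning setoid

  private variable
    x x' y y' z : Carrier
    a b d n : ℕ

  inverse-unique : x * y ≈ 1# → x * z ≈ 1# → y ≈ z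
  inverse-unique {x} {y} {z} xy≈1 xz≈1 = begin
    y            ≈⟨ sym (*-identityʳ y) ⟩
    y * 1#       ≈⟨ *-congˡ (sym xz≈1) ⟩
    y * (x * z)  ≈⟨ sym (*-assoc y x z) ⟩
    (y * x) * z  ≈⟨ *-congʳ (trans (*-comm y x) xy≈1) ⟩
    1# * z       ≈⟨ *-identityˡ z ⟩
    z            ∎

  1#^≈1# : ∀ m → 1# ^ m ≈ 1#
  1#^≈1# zero    = ≈-refl
  1#^≈1# (suc m) = trans (*-identityˡ _) (1#^≈1# m)

  ^-inverse : ∀ m → x * y ≈ 1# → y ^ m ≈ 1# → x ^ m ≈ 1#
  ^-inverse {x} {y} m xy≈1 y^m≈1 = begin
    x ^ m          ≈⟨ sym (*-identityʳ _) ⟩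
    x ^ m * 1#     ≈⟨ *-congˡ (sym y^m≈1) ⟩
    x ^ m * y ^ m  ≈⟨ sym (^-distrib-* x y m) ⟩
    (x * y) ^ m    ≈⟨ ^-congˡ m xy≈1 ⟩
    1# ^ m         ≈⟨ 1#^≈1# m ⟩
    1#             ∎

  ^-odd-involution : ∀ m → x * x ≈ 1# → x ^ suc (2 ℕ.* m) ≈ x
  ^-odd-involution {x} m x²≈1 = begin
    x * x ^ (2 ℕ.* m)  ≈⟨ *-congˡ (sym (^-assocʳ x 2 m)) ⟩
    x * (x ^ 2) ^ m    ≈⟨ *-congˡ (^-congˡ m (trans (*-congˡ (*-identityʳ x)) x²≈1)) ⟩
    x * 1# ^ m         ≈⟨ *-congˡ (1#^≈1# m) ⟩
    x * 1#             ≈⟨ *-identityʳ x ⟩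
    x                  ∎

  frobenius : ℕ → Carrier → Carrier
  frobenius zero    x = x
  frobenius (suc i) x = frobenius i x * frobenius i x

  frobenius-cong : ∀ i → x ≈ y → frobenius i x ≈ frobenius i y
  frobenius-cong zero    x≈y = x≈y
  frobenius-cong (suc i) x≈y = *-cong (frobenius-cong i x≈y) (frobenius-cong i x≈y)

  frobenius-+ : ∀ i j x → frobenius (i ℕ.+ j) x ≡ frobenius i (frobenius j x)
  frobenius-+ zero    j x = refl
  frobenius-+ (suc i) j x = cong (λ y → y * y) (frobenius-+ i j x)

  frobenius≈^ : ∀ i x → frobenius i x ≈ x ^ (2 ℕ.^ i)
  frobenius≈^ zero    x = sym (*-identityʳ x)
  frobenius≈^ (suc i) x = begin
    frobenius i x * frobenius i x  ≈⟨ *-cong (frobenius≈^ i x) (frobenius≈^ i x) ⟩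
    x ^ 2^i * x ^ 2^i              ≈⟨ sym (^-homo-* x 2^i 2^i) ⟩
    x ^ (2^i ℕ.+ 2^i)              ≡⟨ cong (λ m → x ^ (2^i ℕ.+ m)) (≡.sym (ℕₚ.+-identityʳ _)) ⟩
    x ^ (2 ℕ.^ suc i)              ∎
    where
    2^i : ℕ
    2^i = 2 ℕ.^ i

  frobenius-homo-* : ∀ i x y → frobenius i (x * y) ≈ frobenius i x * frobenius i y
  frobenius-homo-* zero    x y = ≈-refl
  frobenius-homo-* (suc i) x y =
    trans (*-cong (frobenius-homo-* i x y) (frobenius-homo-* i x y)) (interchange _ _ _ _)

  frobenius-homo-1# : ∀ i → frobenius i 1# ≈ 1#
  frobenius-homo-1# zero    = ≈-refl
  frobenius-homo-1# (suc i) =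
    trans (*-cong (frobenius-homo-1# i) (frobenius-homo-1# i)) (*-identityˡ 1#)

  frobenius-inverse : ∀ i → x * y ≈ 1# → frobenius i x * frobenius i y ≈ 1#
  frobenius-inverse {x} {y} i xy≈1 =
    trans (sym (frobenius-homo-* i x y)) (trans (frobenius-cong i xy≈1) (frobenius-homo-1# i))

  Conjugate : Carrier → Carrier → Set ℓ
  Conjugate x y = ∃[ i ] y ≈ frobenius i x

  conjugate-trans : Conjugate x y → Conjugate y z → Conjugate x z
  conjugate-trans {x} (i , y≈) (j , z≈) =
    j ℕ.+ i , trans z≈ (trans (frobenius-cong j y≈) (reflexive (≡.sym (frobenius-+ j i x))))

  conjugate-inverse : x * x' ≈ 1# → y * y' ≈ 1# → Conjugate x y → Conjugate x' y'
  conjugate-inverse xx'≈1 yy'≈1 (i , y≈) =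
    i , inverse-unique yy'≈1 (trans (*-congʳ y≈) (frobenius-inverse i xx'≈1))

  Period : Carrier → ℕ → Set ℓ
  Period x a = frobenius a x ≈ x

  period-+ : ∀ a b → Period x a → Period x b → Period x (a ℕ.+ b)
  period-+ {x} a b pa pb = trans (reflexive (frobenius-+ a b x)) (trans (frobenius-cong a pb) pa)

  period-* : ∀ m a → Period x a → Period x (m ℕ.* a)
  period-* zero    a pa = ≈-refl
  period-* (suc m) a pa = period-+ a (m ℕ.* a) pa (period-* m a pa)

  period-∣ : Period x a → a ∣ b → Period x b
  period-∣ {a = a} pa (divides q refl) = period-* q a pa

  period-cancelʳ : ∀ a b → Period x (a ℕ.+ b) → Period x b → Period x a
  period-cancelʳ {x} a b pab pb =
    trans (frobenius-cong a (sym pb)) (trans (reflexive (≡.sym (frobenius-+ a b x))) pab)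

  period-coprime : ∀ i → Coprime d n → Period x n → Period x (d ℕ.* i) → Period x i
  period-coprime {d} {n} {x} i d⊥n pn pdi with coprime-Bézout d⊥n
  ... | Bézout.+- u v 1+vn≡ud =
    period-cancelʳ i (v ℕ.* n ℕ.* i)
      (subst (Period x) (cong (ℕ._* i) (≡.sym 1+vn≡ud)) (period-∣ pdi (*-monoˡ-∣ i (n∣m*n u))))
      (period-∣ pn (n∣m*n*o v i))
  ... | Bézout.-+ u v 1+ud≡vn =
    period-cancelʳ i (u ℕ.* d ℕ.* i)
      (subst (Period x) (cong (ℕ._* i) (≡.sym 1+ud≡vn)) (period-∣ pn (n∣m*n*o v i)))
      (period-∣ pdi (*-monoˡ-∣ i (n∣m*n u)))

  period-2* : ∀ i → frobenius i (frobenius i x) ≈ x → Period x (2 ℕ.* i)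
  period-2* {x} i h rewrite ℕₚ.+-identityʳ i = trans (reflexive (frobenius-+ i i x)) h

  period-3* : ∀ i → frobenius i (frobenius i (frobenius i x)) ≈ x → Period x (3 ℕ.* i)
  period-3* {x} i h rewrite ℕₚ.+-identityʳ i | frobenius-+ i (i ℕ.+ i) x | frobenius-+ i i x = h

  inverse-conjugate⇒fixed : ∀ i → Coprime 2 n → Period x n → x * frobenius i x ≈ 1# → Period x i
  inverse-conjugate⇒fixed {x = x} i 2⊥n pn x*Fx≈1 = period-coprime i 2⊥n pn (period-2* i (sym x≈FFx))
    where
    x≈FFx : x ≈ frobenius i (frobenius i x)
    x≈FFx = inverse-unique (trans (*-comm _ _) x*Fx≈1) (frobenius-inverse i x*Fx≈1)

HasCharacteristic2 : ∀ {c ℓ} → CommutativeRing c ℓ → Set ℓ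
HasCharacteristic2 R = 1# + 1# ≈ 0#
  where open CommutativeRing R

module Characteristic2 {c ℓ : Level} (R : CommutativeRing c ℓ) (1#+1#≈0# : HasCharacteristic2 R) where
  open CommutativeRing R renaming (refl to ≈-refl)
  open Frobenius R
  open ExpProperties commutativeSemiring using (_^_)
  open CommutativeSemigroupProperties +-commutativeSemigroup using () renaming (interchange to +-interchange)
  open SetoidReasoning setoid

  private variable
    x x' y y' z : Carrier
    n : ℕ

  x+x≈0# : ∀ x → x + x ≈ 0#
  x+x≈0# x = begin
    x + x            ≈⟨ sym (+-cong (*-identityˡ x) (*-identityˡ x)) ⟩
    1# * x + 1# * x  ≈⟨ sym (distribʳ x 1# 1#) ⟩
    (1# + 1#) * x    ≈⟨ *-congʳ 1#+1#≈0# ⟩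
    0# * x           ≈⟨ zeroˡ x ⟩
    0#               ∎

  x+y≈z⇒y≈x+z : x + y ≈ z → y ≈ x + z
  x+y≈z⇒y≈x+z {x} {y} {z} x+y≈z = begin
    y            ≈⟨ sym (+-identityˡ y) ⟩
    0# + y       ≈⟨ +-congʳ (sym (x+x≈0# x)) ⟩
    (x + x) + y  ≈⟨ +-assoc x x y ⟩
    x + (x + y)  ≈⟨ +-congˡ x+y≈z ⟩
    x + z        ∎

  1#+[1#+x]≈x : ∀ x → 1# + (1# + x) ≈ x
  1#+[1#+x]≈x x = sym (x+y≈z⇒y≈x+z ≈-refl)

  1#+-injective : 1# + x ≈ 1# + y → x ≈ y
  1#+-injective {x} {y} 1+x≈1+y =
    trans (sym (1#+[1#+x]≈x x)) (trans (+-congˡ 1+x≈1+y) (1#+[1#+x]≈x y))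

  square-homo-+ : ∀ x y → (x + y) * (x + y) ≈ x * x + y * y
  square-homo-+ x y = begin
    (x + y) * (x + y)                  ≈⟨ distribʳ (x + y) x y ⟩
    x * (x + y) + y * (x + y)          ≈⟨ +-cong (distribˡ x x y) (trans (distribˡ y x y) (+-comm _ _)) ⟩
    (x * x + x * y) + (y * y + y * x)  ≈⟨ +-interchange _ _ _ _ ⟩
    (x * x + y * y) + (x * y + y * x)  ≈⟨ +-congˡ (trans (+-congˡ (*-comm y x)) (x+x≈0# (x * y))) ⟩
    (x * x + y * y) + 0#               ≈⟨ +-identityʳ _ ⟩
    x * x + y * y                      ∎

  frobenius-homo-+ : ∀ i x y → frobenius i (x + y) ≈ frobenius i x + frobenius i y
  frobenius-homo-+ zero    x y = ≈-refl
  frobenius-homo-+ (suc i) x y =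
    trans (*-cong (frobenius-homo-+ i x y) (frobenius-homo-+ i x y)) (square-homo-+ _ _)

  frobenius-1#+ : ∀ i x → frobenius i (1# + x) ≈ 1# + frobenius i x
  frobenius-1#+ i x = trans (frobenius-homo-+ i 1# x) (+-congʳ (frobenius-homo-1# i))

  conjugate-1#+ : 1# + x ≈ x' → 1# + y ≈ y' → Conjugate x y → Conjugate x' y'
  conjugate-1#+ {x} {x'} {y} {y'} 1+x≈x' 1+y≈y' (i , y≈) = i , (begin
    y'                    ≈⟨ sym 1+y≈y' ⟩
    1# + y                ≈⟨ +-congˡ y≈ ⟩
    1# + frobenius i x    ≈⟨ sym (frobenius-1#+ i x) ⟩
    frobenius i (1# + x)  ≈⟨ frobenius-cong i 1+x≈x' ⟩
    frobenius i x'        ∎)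

  frobenius≈1#+⇒1#≈0# : ∀ i → Coprime 2 n → Period x n → frobenius i x ≈ 1# + x → 1# ≈ 0#
  frobenius≈1#+⇒1#≈0# {n} {x} i 2⊥n pn Fx≈1+x = begin
    1#             ≈⟨ x+y≈z⇒y≈x+z (trans (+-comm x 1#) (trans (sym Fx≈1+x) Fx≈x)) ⟩
    x + x          ≈⟨ x+x≈0# x ⟩
    0#             ∎
    where
    FFx≈x : frobenius i (frobenius i x) ≈ x
    FFx≈x = begin
      frobenius i (frobenius i x)  ≈⟨ frobenius-cong i Fx≈1+x ⟩
      frobenius i (1# + x)         ≈⟨ frobenius-1#+ i x ⟩
      1# + frobenius i x           ≈⟨ +-congˡ Fx≈1+x ⟩
      1# + (1# + x)                ≈⟨ 1#+[1#+x]≈x x ⟩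
      x                            ∎
    Fx≈x : frobenius i x ≈ x
    Fx≈x = period-coprime i 2⊥n pn (period-2* i FFx≈x)

  -- Φ a b says a = 1/(1 + b); in characteristic 2 the map b ↦ 1/(1 + b) has order 3 (Φ-cycle).
  Φ : Carrier → Carrier → Set ℓ
  Φ a b = a * (1# + b) ≈ 1#

  x*[1#+y]≈x+x*y : ∀ x y → x * (1# + y) ≈ x + x * y
  x*[1#+y]≈x+x*y x y = trans (distribˡ x 1# y) (+-congʳ (*-identityʳ x))

  Φ⇒x*y≈1#+x : Φ x y → x * y ≈ 1# + x
  Φ⇒x*y≈1#+x {x} {y} Φxy =
    trans (x+y≈z⇒y≈x+z (trans (sym (x*[1#+y]≈x+x*y x y)) Φxy)) (+-comm x 1#)

  Φ-cycle : Φ x y → Φ y z → Φ z x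
  Φ-cycle {x} {y} {z} Φxy Φyz = begin
    z * (1# + x)  ≈⟨ *-comm z _ ⟩
    (1# + x) * z  ≈⟨ x+y≈z⇒y≈x+z (sym x≈[1+x]+[1+x]z) ⟩
    (1# + x) + x  ≈⟨ +-assoc 1# x x ⟩
    1# + (x + x)  ≈⟨ +-congˡ (x+x≈0# x) ⟩
    1# + 0#       ≈⟨ +-identityʳ 1# ⟩
    1#            ∎
    where
    x≈[1+x]+[1+x]z : x ≈ (1# + x) + (1# + x) * z
    x≈[1+x]+[1+x]z = begin
      x                        ≈⟨ sym (*-identityʳ x) ⟩
      x * 1#                   ≈⟨ *-congˡ (sym Φyz) ⟩
      x * (y * (1# + z))       ≈⟨ sym (*-assoc x y _) ⟩
      (x * y) * (1# + z)       ≈⟨ *-congʳ (Φ⇒x*y≈1#+x Φxy) ⟩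
      (1# + x) * (1# + z)      ≈⟨ x*[1#+y]≈x+x*y _ z ⟩
      (1# + x) + (1# + x) * z  ∎

  Φ-injective : Φ x y → Φ x z → y ≈ z
  Φ-injective Φxy Φxz = 1#+-injective (inverse-unique Φxy Φxz)

  Φ-frobenius : ∀ i → Φ x y → Φ (frobenius i x) (frobenius i y)
  Φ-frobenius {y = y} i Φxy = trans (*-congˡ (sym (frobenius-1#+ i y))) (frobenius-inverse i Φxy)

  Φ-diagonal⇒^3≈1# : Φ x x → x ^ 3 ≈ 1#
  Φ-diagonal⇒^3≈1# {x} Φxx = begin
    x * (x * (x * 1#))  ≈⟨ *-congˡ (*-congˡ (*-identityʳ x)) ⟩
    x * (x * x)         ≈⟨ *-congˡ (Φ⇒x*y≈1#+x Φxx) ⟩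
    x * (1# + x)        ≈⟨ Φxx ⟩
    1#                  ∎

  Φ-conjugate⇒^3≈1# : ∀ i → Coprime 3 n → Period x n → Φ x (frobenius i x) → x ^ 3 ≈ 1#
  Φ-conjugate⇒^3≈1# {n} {x} i 3⊥n pn Φ₀ =
    Φ-diagonal⇒^3≈1# (trans (*-congˡ (+-congˡ (sym Fx≈x))) Φ₀)
    where
    Φ₁ : Φ (frobenius i x) (frobenius i (frobenius i x))
    Φ₁ = Φ-frobenius i Φ₀
    F³x≈x : frobenius i (frobenius i (frobenius i x)) ≈ x
    F³x≈x = Φ-injective (Φ-frobenius i Φ₁) (Φ-cycle Φ₀ Φ₁)
    Fx≈x : frobenius i x ≈ x
    Fx≈x = period-coprime i 3⊥n pn (period-3* i F³x≈x)

module PrimitiveElement {c ℓ : Level} (R : CommutativeRing c ℓ)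
  (n : ℕ) .{{_ : NonZero n}} (ξ : CommutativeRing.Carrier R)
  (isField : FieldDefs.IsField R) (isPrimitive : FieldDefs.IsPrimitiveOf R n ξ) where
  open CommutativeRing R renaming (refl to ≈-refl)
  open RingProperties ring using (-1*x≈-x; -‿involutive; -0#≈0#)
  open ExpProperties commutativeSemiring
  open Frobenius R
  open FieldDefs R using (IsZech)
  open ZN n using (neg; InC; SameClass; ThreeKZero)
  open SetoidReasoning setoid

  private
    N : ℕ
    N = Nn n

    instance
      N-nonZero : NonZero N
      N-nonZero = Nn-nonZero n

    variable
      a b j k w z z' : ℕ

  1#≉0# : ¬ 1# ≈ 0#
  1#≉0# = proj₁ isField

  ξ^N≈1# : ξ ^ N ≈ 1#
  ξ^N≈1# = proj₁ isPrimitive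

  ξ^≉1# : 0 < k → k < N → ¬ ξ ^ k ≈ 1#
  ξ^≉1# = proj₁ (proj₂ isPrimitive) _

  ξ^[m*N]≈1# : ∀ m → ξ ^ (m ℕ.* N) ≈ 1#
  ξ^[m*N]≈1# zero    = ≈-refl
  ξ^[m*N]≈1# (suc m) = begin
    ξ ^ (N ℕ.+ m ℕ.* N)      ≈⟨ ^-homo-* ξ N (m ℕ.* N) ⟩
    ξ ^ N * ξ ^ (m ℕ.* N)    ≈⟨ *-cong ξ^N≈1# (ξ^[m*N]≈1# m) ⟩
    1# * 1#                  ≈⟨ *-identityˡ 1# ⟩
    1#                       ∎

  [ξ^k]^N≈1# : ∀ k → (ξ ^ k) ^ N ≈ 1#
  [ξ^k]^N≈1# k = trans (^-assocʳ ξ k N) (ξ^[m*N]≈1# k)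

  ξ^≈ξ^% : ∀ a → ξ ^ a ≈ ξ ^ (a % N)
  ξ^≈ξ^% a = begin
    ξ ^ a                                ≡⟨ cong (ξ ^_) (m≡m%n+[m/n]*n a N) ⟩
    ξ ^ (a % N ℕ.+ (a / N) ℕ.* N)        ≈⟨ ^-homo-* ξ (a % N) _ ⟩
    ξ ^ (a % N) * ξ ^ ((a / N) ℕ.* N)    ≈⟨ *-congˡ (ξ^[m*N]≈1# (a / N)) ⟩
    ξ ^ (a % N) * 1#                     ≈⟨ *-identityʳ _ ⟩
    ξ ^ (a % N)                          ∎

  ξ^-cong-% : a % N ≡ b % N → ξ ^ a ≈ ξ ^ b
  ξ^-cong-% {a} {b} a%N≡b%N =
    trans (ξ^≈ξ^% a) (trans (reflexive (cong (ξ ^_) a%N≡b%N)) (sym (ξ^≈ξ^% b)))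

  ξ^-inverse : a ≤ N → ξ ^ a * ξ ^ (N ℕ.∸ a) ≈ 1#
  ξ^-inverse {a} a≤N = begin
    ξ ^ a * ξ ^ (N ℕ.∸ a)    ≈⟨ sym (^-homo-* ξ a (N ℕ.∸ a)) ⟩
    ξ ^ (a ℕ.+ (N ℕ.∸ a))    ≡⟨ cong (ξ ^_) (ℕₚ.m+[n∸m]≡n a≤N) ⟩
    ξ ^ N                    ≈⟨ ξ^N≈1# ⟩
    1#                       ∎

  ξ^-inverse-neg : a ≤ N → ξ ^ a * ξ ^ neg a ≈ 1#
  ξ^-inverse-neg {a} a≤N = trans (*-congˡ (sym (ξ^≈ξ^% (N ℕ.∸ a)))) (ξ^-inverse a≤N)

  ξ^-cancelˡ : ∀ d → a ≤ N → ξ ^ (a ℕ.+ d) ≈ ξ ^ a → ξ ^ d ≈ 1#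
  ξ^-cancelˡ {a} d a≤N ξ^[a+d]≈ξ^a = begin
    ξ ^ d                            ≈⟨ sym (*-identityˡ _) ⟩
    1# * ξ ^ d                       ≈⟨ *-congʳ (sym (trans (*-comm _ _) (ξ^-inverse a≤N))) ⟩
    (ξ ^ (N ℕ.∸ a) * ξ ^ a) * ξ ^ d  ≈⟨ *-assoc _ _ _ ⟩
    ξ ^ (N ℕ.∸ a) * (ξ ^ a * ξ ^ d)  ≈⟨ *-congˡ (sym (^-homo-* ξ a d)) ⟩
    ξ ^ (N ℕ.∸ a) * ξ ^ (a ℕ.+ d)    ≈⟨ *-congˡ ξ^[a+d]≈ξ^a ⟩
    ξ ^ (N ℕ.∸ a) * ξ ^ a            ≈⟨ trans (*-comm _ _) (ξ^-inverse a≤N) ⟩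
    1#                               ∎

  ξ^-injective-<N : a ≤ b → b < N → ξ ^ a ≈ ξ ^ b → a ≡ b
  ξ^-injective-<N {a} a≤b b<N ξ^a≈ξ^b with ℕₚ.m≤n⇒∃[o]m+o≡n a≤b
  ... | zero  , a+0≡b = ≡.trans (≡.sym (ℕₚ.+-identityʳ a)) a+0≡b
  ... | suc d , refl  = contradiction
    (ξ^-cancelˡ (suc d) (ℕₚ.<⇒≤ (ℕₚ.≤-<-trans (ℕₚ.m≤m+n a (suc d)) b<N)) (sym ξ^a≈ξ^b))
    (ξ^≉1# (s≤s z≤n) (ℕₚ.≤-<-trans (ℕₚ.m≤n+m (suc d) a) b<N))

  ξ^-injective : ξ ^ a ≈ ξ ^ b → a % N ≡ b % N
  ξ^-injective {a} {b} ξ^a≈ξ^b with ℕₚ.≤-total (a % N) (b % N)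
  ... | inj₁ a%N≤b%N = ξ^-injective-<N a%N≤b%N (m%n<n b N) ξ^[a%N]≈ξ^[b%N]
    where
    ξ^[a%N]≈ξ^[b%N] : ξ ^ (a % N) ≈ ξ ^ (b % N)
    ξ^[a%N]≈ξ^[b%N] = trans (sym (ξ^≈ξ^% a)) (trans ξ^a≈ξ^b (ξ^≈ξ^% b))
  ... | inj₂ b%N≤a%N = ≡.sym (ξ^-injective-<N b%N≤a%N (m%n<n a N) ξ^[b%N]≈ξ^[a%N])
    where
    ξ^[b%N]≈ξ^[a%N] : ξ ^ (b % N) ≈ ξ ^ (a % N)
    ξ^[b%N]≈ξ^[a%N] = trans (sym (ξ^≈ξ^% b)) (trans (sym ξ^a≈ξ^b) (ξ^≈ξ^% a))

  ξ^-square≈1#⇒≈1# : ∀ k → ξ ^ k * ξ ^ k ≈ 1# → ξ ^ k ≈ 1#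
  ξ^-square≈1#⇒≈1# k square≈1 with Nn-odd n
  ... | m , N≡1+2m = begin
    ξ ^ k                          ≈⟨ sym (^-odd-involution m square≈1) ⟩
    (ξ ^ k) ^ suc (2 ℕ.* m)        ≡⟨ cong ((ξ ^ k) ^_) (≡.sym N≡1+2m) ⟩
    (ξ ^ k) ^ N                    ≈⟨ [ξ^k]^N≈1# k ⟩
    1#                             ∎

  -1#≉0# : ¬ - 1# ≈ 0#
  -1#≉0# -1#≈0# = 1#≉0# (trans (sym (-‿involutive 1#)) (trans (-‿cong -1#≈0#) -0#≈0#))

  -1#≈1# : - 1# ≈ 1#
  -1#≈1# with proj₂ (proj₂ isPrimitive) (- 1#) -1#≉0#
  ... | t , _ , -1#≈ξ^t = trans -1#≈ξ^t (ξ^-square≈1#⇒≈1# t (begin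
    ξ ^ t * ξ ^ t  ≈⟨ *-cong (sym -1#≈ξ^t) (sym -1#≈ξ^t) ⟩
    - 1# * - 1#    ≈⟨ -1*x≈-x (- 1#) ⟩
    - (- 1#)       ≈⟨ -‿involutive 1# ⟩
    1#             ∎))

  1#+1#≈0# : 1# + 1# ≈ 0#
  1#+1#≈0# = trans (+-congˡ (sym -1#≈1#)) (-‿inverseʳ 1#)

  open Characteristic2 R 1#+1#≈0#

  frobenius-ξ^ : ∀ i k → frobenius i (ξ ^ k) ≈ ξ ^ (2 ℕ.^ i ℕ.* k)
  frobenius-ξ^ i k = begin
    frobenius i (ξ ^ k)    ≈⟨ frobenius≈^ i (ξ ^ k) ⟩
    (ξ ^ k) ^ (2 ℕ.^ i)    ≈⟨ ^-assocʳ ξ k (2 ℕ.^ i) ⟩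
    ξ ^ (k ℕ.* 2 ℕ.^ i)    ≡⟨ cong (ξ ^_) (ℕₚ.*-comm k (2 ℕ.^ i)) ⟩
    ξ ^ (2 ℕ.^ i ℕ.* k)    ∎

  ξ^-period : ∀ k → Period (ξ ^ k) n
  ξ^-period k = begin
    frobenius n (ξ ^ k)    ≈⟨ frobenius≈^ n (ξ ^ k) ⟩
    (ξ ^ k) ^ (2 ℕ.^ n)    ≡⟨ cong ((ξ ^ k) ^_) (≡.sym (suc[Nn]≡2^n n)) ⟩
    ξ ^ k * (ξ ^ k) ^ N    ≈⟨ *-congˡ ([ξ^k]^N≈1# k) ⟩
    ξ ^ k * 1#             ≈⟨ *-identityʳ _ ⟩
    ξ ^ k                  ∎

  inC⇒conjugate : InC a j → Conjugate (ξ ^ a) (ξ ^ j)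
  inC⇒conjugate {a} (i , j≡2^i*a) = i , trans (ξ^-cong-% j≡2^i*a) (sym (frobenius-ξ^ i a))

  conjugate⇒inC : Conjugate (ξ ^ a) (ξ ^ j) → InC a j
  conjugate⇒inC {a} (i , ξ^j≈) = i , ξ^-injective (trans ξ^j≈ (frobenius-ξ^ i a))

  sameClass-sym : SameClass a b → SameClass b a
  sameClass-sym sc j = swap (sc j)

  sameClass⇒conjugate : SameClass a b → Conjugate (ξ ^ a) (ξ ^ b)
  sameClass⇒conjugate {b = b} sc =
    inC⇒conjugate (proj₂ (sc b) (0 , cong (_% N) (≡.sym (ℕₚ.+-identityʳ b))))

  conjugate⇒sameClass : Conjugate (ξ ^ a) (ξ ^ b) → Conjugate (ξ ^ b) (ξ ^ a) → SameClass a b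
  conjugate⇒sameClass a∼b b∼a j =
      (λ j∈C[a] → conjugate⇒inC (conjugate-trans b∼a (inC⇒conjugate j∈C[a])))
    , (λ j∈C[b] → conjugate⇒inC (conjugate-trans a∼b (inC⇒conjugate j∈C[b])))

  sameClass-neg : a ≤ N → b ≤ N → SameClass a b → SameClass (neg a) (neg b)
  sameClass-neg a≤N b≤N sc = conjugate⇒sameClass
    (conjugate-inverse (ξ^-inverse-neg a≤N) (ξ^-inverse-neg b≤N) (sameClass⇒conjugate sc))
    (conjugate-inverse (ξ^-inverse-neg b≤N) (ξ^-inverse-neg a≤N) (sameClass⇒conjugate (sameClass-sym sc)))

  sameClass-zech : IsZech ξ a z → IsZech ξ b z' → SameClass a b → SameClass z z'
  sameClass-zech ζa ζb sc = conjugate⇒sameClass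
    (conjugate-1#+ ζa ζb (sameClass⇒conjugate sc))
    (conjugate-1#+ ζb ζa (sameClass⇒conjugate (sameClass-sym sc)))

  ¬sameClass-neg : ¬ 2 ∣ n → 0 < k → k < N → ¬ SameClass k (neg k)
  ¬sameClass-neg {k} 2∤n 0<k k<N sc with sameClass⇒conjugate sc
  ... | i , ξ^-k≈Fξ^k =
    ξ^≉1# 0<k k<N (ξ^-square≈1#⇒≈1# k (trans (*-congˡ (sym Fξ^k≈ξ^k)) ξ^k*Fξ^k≈1#))
    where
    ξ^k*Fξ^k≈1# : ξ ^ k * frobenius i (ξ ^ k) ≈ 1#
    ξ^k*Fξ^k≈1# = trans (*-congˡ (sym ξ^-k≈Fξ^k)) (ξ^-inverse-neg (ℕₚ.<⇒≤ k<N))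
    Fξ^k≈ξ^k : frobenius i (ξ ^ k) ≈ ξ ^ k
    Fξ^k≈ξ^k = inverse-conjugate⇒fixed i (prime∤⇒coprime prime[2] 2∤n) (ξ^-period k) ξ^k*Fξ^k≈1#

  ¬conjugate-zech : ¬ 2 ∣ n → IsZech ξ a z → ¬ Conjugate (ξ ^ a) (ξ ^ z)
  ¬conjugate-zech {a} 2∤n ζ (i , ξ^z≈Fξ^a) = 1#≉0# (frobenius≈1#+⇒1#≈0# i
    (prime∤⇒coprime prime[2] 2∤n) (ξ^-period a) (trans (sym ξ^z≈Fξ^a) (sym ζ)))

  ¬sameClass-zech : ¬ 2 ∣ n → IsZech ξ k z → ¬ SameClass k z
  ¬sameClass-zech {k} {z} 2∤n ζ sc = ¬conjugate-zech {k} {z} 2∤n ζ (sameClass⇒conjugate sc)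

  ¬sameClass-neg∘zech∘neg : ¬ 2 ∣ n → k < N → w < N → IsZech ξ (neg k) w → ¬ SameClass k (neg w)
  ¬sameClass-neg∘zech∘neg {k} {w} 2∤n k<N w<N ζ sc =
    ¬conjugate-zech {neg k} {w} 2∤n ζ (conjugate-inverse ξ^k*ξ^-k≈1# ξ^-w*ξ^w≈1# (sameClass⇒conjugate sc))
    where
    ξ^k*ξ^-k≈1# : ξ ^ k * ξ ^ neg k ≈ 1#
    ξ^k*ξ^-k≈1# = ξ^-inverse-neg (ℕₚ.<⇒≤ k<N)
    ξ^-w*ξ^w≈1# : ξ ^ neg w * ξ ^ w ≈ 1#
    ξ^-w*ξ^w≈1# = trans (*-comm _ _) (ξ^-inverse-neg (ℕₚ.<⇒≤ w<N))

  ^3≈1#⇒threeKZero : ∀ k → (ξ ^ k) ^ 3 ≈ 1# → ThreeKZero k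
  ^3≈1#⇒threeKZero k [ξ^k]^3≈1# = ≡.trans (ξ^-injective {b = 0} ξ^3k≈1#) (m*n%n≡0 0 N)
    where
    ξ^3k≈1# : ξ ^ (3 ℕ.* k) ≈ 1#
    ξ^3k≈1# = begin
      ξ ^ (3 ℕ.* k)  ≡⟨ cong (ξ ^_) (ℕₚ.*-comm 3 k) ⟩
      ξ ^ (k ℕ.* 3)  ≈⟨ sym (^-assocʳ ξ k 3) ⟩
      (ξ ^ k) ^ 3    ≈⟨ [ξ^k]^3≈1# ⟩
      1#             ∎

  ¬sameClass-neg∘zech : ¬ 3 ∣ n → ¬ ThreeKZero k → z < N → IsZech ξ k z → ¬ SameClass (neg z) k
  ¬sameClass-neg∘zech {k} {z} 3∤n 3k≢0 z<N ζ sc with sameClass⇒conjugate sc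
  ... | i , ξ^k≈Fξ^-z = 3k≢0 (^3≈1#⇒threeKZero k
    (Φ-conjugate⇒^3≈1# i (prime∤⇒coprime prime[3] 3∤n) (ξ^-period k) Φ[ξ^k,Fξ^k]))
    where
    Φ[ξ^-z,ξ^k] : Φ (ξ ^ neg z) (ξ ^ k)
    Φ[ξ^-z,ξ^k] = trans (*-congˡ ζ) (trans (*-comm _ _) (ξ^-inverse-neg (ℕₚ.<⇒≤ z<N)))
    Φ[ξ^k,Fξ^k] : Φ (ξ ^ k) (frobenius i (ξ ^ k))
    Φ[ξ^k,Fξ^k] = trans (*-congʳ ξ^k≈Fξ^-z) (Φ-frobenius i Φ[ξ^-z,ξ^k])

  ¬sameClass-zech∘neg : ¬ 3 ∣ n → k < N → ¬ ThreeKZero k → IsZech ξ (neg k) w → ¬ SameClass k w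
  ¬sameClass-zech∘neg {k} {w} 3∤n k<N 3k≢0 ζ sc with sameClass⇒conjugate (sameClass-sym sc)
  ... | i , ξ^k≈Fξ^w = 3k≢0 (^3≈1#⇒threeKZero k (^-inverse 3 (ξ^-inverse-neg (ℕₚ.<⇒≤ k<N))
    (Φ-conjugate⇒^3≈1# i (prime∤⇒coprime prime[3] 3∤n) (ξ^-period (neg k)) Φ[ξ^-k,Fξ^-k])))
    where
    Φ[ξ^-k,Fξ^-k] : Φ (ξ ^ neg k) (frobenius i (ξ ^ neg k))
    Φ[ξ^-k,Fξ^-k] = begin
      ξ ^ neg k * (1# + frobenius i (ξ ^ neg k))  ≈⟨ *-congˡ (sym (frobenius-1#+ i _)) ⟩
      ξ ^ neg k * frobenius i (1# + ξ ^ neg k)    ≈⟨ *-congˡ (frobenius-cong i ζ) ⟩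
      ξ ^ neg k * frobenius i (ξ ^ w)             ≈⟨ *-congˡ (sym ξ^k≈Fξ^w) ⟩
      ξ ^ neg k * ξ ^ k                           ≈⟨ trans (*-comm _ _) (ξ^-inverse-neg (ℕₚ.<⇒≤ k<N)) ⟩
      1#                                          ∎

proposition4 : ∀ {c ℓ : Level} (R : CommutativeRing c ℓ)
    (n : ℕ) .{{_ : NonZero n}} (ξ : CommutativeRing.Carrier R) →
    FieldDefs.IsField R →
    FieldDefs.IsPrimitiveOf R n ξ →
    -- (i)
    (∀ k k' → 0 < k → k < Nn n → 0 < k' → k' < Nn n →
      ZN.SameClass n k k' →
        ZN.SameClass n (ZN.neg n k) (ZN.neg n k')
        × (∀ z z' → z < Nn n → z' < Nn n →
             FieldDefs.IsZech R ξ k z → FieldDefs.IsZech R ξ k' z' →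
             ZN.SameClass n z z'))
    -- (ii)
    × (¬ (2 ∣ n) → ∀ k → 0 < k → k < Nn n →
        ¬ ZN.SameClass n k (ZN.neg n k)
        × (∀ z → z < Nn n → FieldDefs.IsZech R ξ k z → ¬ ZN.SameClass n k z)
        × (∀ w → w < Nn n → FieldDefs.IsZech R ξ (ZN.neg n k) w →
             ¬ ZN.SameClass n k (ZN.neg n w)))
    -- (iii)
    × (¬ (3 ∣ n) → ∀ k → 0 < k → k < Nn n → ¬ ZN.ThreeKZero n k →
        (∀ z → z < Nn n → FieldDefs.IsZech R ξ k z →
             ¬ ZN.SameClass n (ZN.neg n z) k)
        × (∀ w → w < Nn n → FieldDefs.IsZech R ξ (ZN.neg n k) w →
             ¬ ZN.SameClass n k w))
proposition4 R n ξ isField isPrimitive =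
    (λ k k' _ k<N _ k'<N sc →
        sameClass-neg (ℕₚ.<⇒≤ k<N) (ℕₚ.<⇒≤ k'<N) sc
      , λ z z' _ _ ζ ζ' → sameClass-zech ζ ζ' sc)
  , (λ 2∤n k 0<k k<N →
        ¬sameClass-neg 2∤n 0<k k<N
      , (λ z _ → ¬sameClass-zech 2∤n)
      , (λ w w<N → ¬sameClass-neg∘zech∘neg 2∤n k<N w<N))
  , (λ 3∤n k _ k<N 3k≢0 →
        (λ z z<N → ¬sameClass-neg∘zech 3∤n 3k≢0 z<N)
      , (λ w _ → ¬sameClass-zech∘neg 3∤n k<N 3k≢0))
  where open PrimitiveElement R n ξ isField isPrimitive
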